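{- Let $G$ be a finite simple graph with $n$ vertices. Then there exists an irreducibly odd graph $G'$ such that $G$ is an induced subgraph of $G'$.
   Context: All graphs are finite and simple. A graph is \emph{odd} if every vertex has odd degree. A graph $G$ is \emph{irreducibly odd} if it is odd and for every pair of distinct vertices $u,v$ of $G$ there exists a third vertex $w \notin \{u,v\}$ that is adjacent to exactly one of $u$ and $v$. -}

module Defs where

open import Data.Nat using (ℕ)
open import Data.Nat.Base using (_%_)
open import Data.Bool using (Bool; true; false; _xor_)
open import Data.Fin using (Fin)
open import Data.Vec using (count; tabulate)
open import Data.Bool using (_≟_)
open import Data.Product using (Σ; ∃; _×_; _,_)
open import Relation.Binary.PropositionalEquality using (_≡_; _≢_)
open import Function.Definitions using (Injective)
open import Relation.Unary using (Pred)

record Graph (n : ℕ) : Set where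
  field
    adj   : Fin n → Fin n → Bool
    sym   : ∀ u v → adj u v ≡ adj v u
    irref : ∀ v → adj v v ≡ false
open Graph public

degree : ∀ {n} → Graph n → Fin n → ℕ
degree G v = count (λ b → b ≟ true) (tabulate (adj G v))

IsOdd : ∀ {n} → Graph n → Set
IsOdd G = ∀ v → degree G v % 2 ≡ 1

IsIrreduciblyOdd : ∀ {n} → Graph n → Set
IsIrreduciblyOdd {n} G =
  IsOdd G ×
  (∀ (u v : Fin n) → u ≢ v →
     ∃ λ (w : Fin n) → w ≢ u × w ≢ v × (adj G w u xor adj G w v) ≡ true)

IsInducedSubgraphOf : ∀ {n m} → Graph n → Graph m → Set
IsInducedSubgraphOf {n} {m} G H =
  Σ (Fin n → Fin m) λ f →
    Injective _≡_ _≡_ f × (∀ u v → adj H (f u) (f v) ≡ adj G u v)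

module Submission where

-- The graph G′ is a layered graph on six copies ("layers") of the vertex
-- set of G.  Between any two layers we place one of four kinds of edge sets
-- on Fin n: nothing, the identity matching, a copy of G, or the "parity
-- matching" joining i to its twin exactly when deg_G(i) is even.  The
-- layout chosen below puts a copy of G on layers 0 and 1, joins them by the
-- parity matching, and adds identity matchings so that
--   * every vertex has odd degree: d + [d even] + 4, d + [d even] + 2 or 3;
--   * every layer is matched to another one, and for any two layers there
--     is a third one matched to one of them and not joined to the other.

open import Defs hiding (sym)
open import Data.Nat using (ℕ)
open import Data.Product using (Σ; _×_)

open import Data.Nat using (zero; suc; _+_; _*_; _%_)
open import Data.Nat.Properties using (+-assoc; +-comm)
open import Data.Nat.DivMod using ([m+kn]%n≡m%n)
open import Data.Bool using (Bool; true; false; _∧_; _xor_)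
open import Data.Bool using () renaming (_≟_ to _≟ᵇ_)
open import Data.Bool.Properties using (∧-identityʳ; ∧-zeroʳ)
open import Data.Fin using (Fin; zero; suc; combine; remQuot; _↑ˡ_; _↑ʳ_)
open import Data.Fin.Properties
  using (_≟_; all?; any?; remQuot-combine; combine-surjective; combine-injectiveˡ; combine-injectiveʳ)
open import Data.Vec using (Vec; []; _∷_; lookup; tabulate; count; sum)
open import Data.Vec.Properties using (tabulate-cong)
open import Data.Product using (_,_; ∃)
open import Data.Sum using (_⊎_; inj₁; inj₂)
open import Data.Unit using (tt)
open import Function using (_∘_)
open import Relation.Nullary using (¬?; yes; no; does)
open import Relation.Nullary.Decidable using (toWitness; dec-true; dec-false; _×-dec_; _⊎-dec_; _→-dec_)
open import Relation.Binary.PropositionalEquality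
  using (_≡_; _≢_; _≗_; refl; sym; trans; cong; cong₂; module ≡-Reasoning)

size : ∀ {n} → (Fin n → Bool) → ℕ
size f = count (_≟ᵇ true) (tabulate f)

bit : Bool → ℕ
bit true  = 1
bit false = 0

size-suc : ∀ {n} (f : Fin (suc n) → Bool) → size f ≡ bit (f zero) + size (f ∘ suc)
size-suc f with f zero
... | true  = refl
... | false = refl

size-cong : ∀ {n} {f g : Fin n → Bool} → f ≗ g → size f ≡ size g
size-cong f≗g = cong (count (_≟ᵇ true)) (tabulate-cong f≗g)

size-false : ∀ n → size {n} (λ _ → false) ≡ 0
size-false zero    = refl
size-false (suc n) = size-false n

size-singleton : ∀ {n} (i : Fin n) → size (λ j → does (i ≟ j)) ≡ 1
size-singleton {suc n} zero = cong suc (size-false n)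
size-singleton (suc i)      = size-singleton i

size-++ : ∀ m {n} (f : Fin (m + n) → Bool) →
          size f ≡ size (f ∘ (_↑ˡ n)) + size (f ∘ (m ↑ʳ_))
size-++ zero    f = refl
size-++ (suc m) {n} f = begin
  size f                                          ≡⟨ size-suc f ⟩
  bit (f zero) + size (f ∘ suc)                   ≡⟨ cong (bit (f zero) +_) (size-++ m (f ∘ suc)) ⟩
  bit (f zero) + (size (f ∘ suc ∘ (_↑ˡ n)) + r)   ≡⟨ sym (+-assoc (bit (f zero)) _ r) ⟩
  bit (f zero) + size (f ∘ suc ∘ (_↑ˡ n)) + r     ≡⟨ cong (_+ r) (sym (size-suc (f ∘ (_↑ˡ n)))) ⟩
  size (f ∘ (_↑ˡ n)) + r                          ∎
  where
  open ≡-Reasoning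
  r = size (f ∘ (suc m ↑ʳ_))

size-combine : ∀ k {n} (f : Fin (k * n) → Bool) →
               size f ≡ sum (tabulate (λ x → size (λ j → f (combine {k} {n} x j))))
size-combine zero    f = refl
size-combine (suc k) {n} f =
  trans (size-++ n {k * n} f) (cong (size (λ j → f (j ↑ˡ (k * n))) +_) (size-combine k {n} (f ∘ (n ↑ʳ_))))

isEven : ℕ → Bool
isEven zero          = true
isEven (suc zero)    = false
isEven (suc (suc d)) = isEven d

parity-completion : ∀ d → (d + bit (isEven d)) % 2 ≡ 1
parity-completion zero          = refl
parity-completion (suc zero)    = refl
parity-completion (suc (suc d)) = parity-completion d

parity-completion-+-even : ∀ d k → (d + bit (isEven d) + k * 2) % 2 ≡ 1
parity-completion-+-even d k = trans ([m+kn]%n≡m%n (d + bit (isEven d)) k 2) (parity-completion d)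

Distinguishes : ∀ {n} → Graph n → Fin n → Fin n → Fin n → Set
Distinguishes G w u v = w ≢ u × w ≢ v × (adj G w u xor adj G w v) ≡ true

-- The graph on k layers, each a copy of Fin n, in which vertex i of layer x
-- and vertex j of layer y are adjacent iff R x y i j.  The vertex (x , i)
-- is combine x i : Fin (k * n).
module Layered {k n : ℕ} (R : Fin k → Fin k → Fin n → Fin n → Bool)
               (R-sym : ∀ x y i j → R x y i j ≡ R y x j i)
               (R-irrefl : ∀ x i → R x x i i ≡ false) where

  private
    edge : Fin k × Fin n → Fin k × Fin n → Bool
    edge (x , i) (y , j) = R x y i j

    edge-sym : ∀ p q → edge p q ≡ edge q p
    edge-sym (x , i) (y , j) = R-sym x y i j

    edge-irrefl : ∀ p → edge p p ≡ false
    edge-irrefl (x , i) = R-irrefl x i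

  graph : Graph (k * n)
  graph = record
    { adj   = λ u v → edge (remQuot n u) (remQuot n v)
    ; sym   = λ u v → edge-sym (remQuot n u) (remQuot n v)
    ; irref = λ u → edge-irrefl (remQuot n u)
    }

  adj-combine : ∀ x i y j → adj graph (combine x i) (combine y j) ≡ R x y i j
  adj-combine x i y j = cong₂ edge (remQuot-combine x i) (remQuot-combine y j)

  degree-combine : ∀ x i → degree graph (combine x i) ≡ sum (tabulate (λ y → size (R x y i)))
  degree-combine x i =
    trans (size-combine k {n} (adj graph (combine x i)))
          (cong sum (tabulate-cong (λ y → size-cong (adj-combine x i y))))

  layer-embedding : ∀ {G : Graph n} x → (∀ i j → R x x i j ≡ adj G i j) →
                    IsInducedSubgraphOf G graph
  layer-embedding x R≡G =
    combine x , (λ {i} {j} → combine-injectiveʳ x i x j) ,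
    λ i j → trans (adj-combine x i x j) (R≡G i j)

  layer-distinguishes : ∀ z l {x i y j} → z ≢ x → z ≢ y →
                        (R z x l i xor R z y l j) ≡ true →
                        Distinguishes graph (combine z l) (combine x i) (combine y j)
  layer-distinguishes z l {x} {i} {y} {j} z≢x z≢y differ =
    z≢x ∘ combine-injectiveˡ z l x i ,
    z≢y ∘ combine-injectiveˡ z l y j ,
    trans (cong₂ _xor_ (adj-combine z l x i) (adj-combine z l y j)) differ

  Matched Empty : Fin k → Fin k → Set
  Matched z x = ∀ l i → R z x l i ≡ does (l ≟ i)
  Empty   z x = ∀ l i → R z x l i ≡ false

  distinguished :
    (∀ x → ∃ λ z → z ≢ x × Matched z x) →
    (∀ x y → x ≢ y → ∃ λ z → z ≢ x × z ≢ y × (Matched z x × Empty z y ⊎ Empty z x × Matched z y)) →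
    ∀ u v → u ≢ v → ∃ λ w → Distinguishes graph w u v
  distinguished matched separated u v u≢v
    with combine-surjective {k} {n} u | combine-surjective {k} {n} v
  ... | x , i , refl | y , j , refl with x ≟ y
  ... | yes refl =
    let z , z≢x , M = matched x in
    combine z i , layer-distinguishes z i z≢x z≢x (begin
      R z x i i xor R z x i j             ≡⟨ cong₂ _xor_ (M i i) (M i j) ⟩
      does (i ≟ i) xor does (i ≟ j)       ≡⟨ cong₂ _xor_ (dec-true (i ≟ i) refl)
                                                         (dec-false (i ≟ j) (u≢v ∘ cong (combine x))) ⟩
      true                                ∎)
    where open ≡-Reasoning
  ... | no x≢y with separated x y x≢y
  ... | z , z≢x , z≢y , inj₁ (M , E) =
    combine z i , layer-distinguishes z i z≢x z≢y
      (cong₂ _xor_ (trans (M i i) (dec-true (i ≟ i) refl)) (E i j))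
  ... | z , z≢x , z≢y , inj₂ (E , M) =
    combine z j , layer-distinguishes z j z≢x z≢y
      (cong₂ _xor_ (E j i) (trans (M j j) (dec-true (j ≟ j) refl)))

-- The four kinds of edge sets between two layers, coded in Fin 4 so that
-- the properties of the layout below are decidable by computation.
Kind : Set
Kind = Fin 4

pattern none   = zero
pattern match  = suc zero
pattern copy   = suc (suc zero)
pattern parity = suc (suc (suc zero))

weight : Kind → ℕ → ℕ
weight none   d = 0
weight match  d = 1
weight copy   d = d
weight parity d = bit (isEven d)

does-≟-sym : ∀ {n} (i j : Fin n) → does (i ≟ j) ≡ does (j ≟ i)
does-≟-sym i j with i ≟ j
... | yes i≡j = sym (dec-true (j ≟ i) (sym i≡j))
... | no  i≢j = sym (dec-false (j ≟ i) (i≢j ∘ sym))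

module EdgeKinds {n : ℕ} (G : Graph n) where

  ⟦_⟧ : Kind → Fin n → Fin n → Bool
  ⟦ none   ⟧ i j = false
  ⟦ match  ⟧ i j = does (i ≟ j)
  ⟦ copy   ⟧ i j = adj G i j
  ⟦ parity ⟧ i j = does (i ≟ j) ∧ isEven (degree G i)

  ⟦⟧-sym : ∀ κ i j → ⟦ κ ⟧ i j ≡ ⟦ κ ⟧ j i
  ⟦⟧-sym none   i j = refl
  ⟦⟧-sym match  i j = does-≟-sym i j
  ⟦⟧-sym copy   i j = Graph.sym G i j
  ⟦⟧-sym parity i j with i ≟ j
  ... | yes refl = cong (_∧ isEven (degree G i)) (sym (dec-true (i ≟ i) refl))
  ... | no  i≢j rewrite dec-false (j ≟ i) (i≢j ∘ sym) = refl

  ⟦⟧-loopless : ∀ κ → κ ≡ none ⊎ κ ≡ copy → ∀ i → ⟦ κ ⟧ i i ≡ false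
  ⟦⟧-loopless none (inj₁ refl) i = refl
  ⟦⟧-loopless copy (inj₂ refl) i = irref G i

  size-⟦⟧ : ∀ κ i → size (⟦ κ ⟧ i) ≡ weight κ (degree G i)
  size-⟦⟧ none   i = size-false n
  size-⟦⟧ match  i = size-singleton i
  size-⟦⟧ copy   i = refl
  size-⟦⟧ parity i with isEven (degree G i)
  ... | true  = trans (size-cong (λ j → ∧-identityʳ (does (i ≟ j)))) (size-singleton i)
  ... | false = trans (size-cong (λ j → ∧-zeroʳ (does (i ≟ j)))) (size-false n)

layoutTable : Vec (Vec Kind 6) 6
layoutTable = (copy   ∷ parity ∷ match ∷ match ∷ match ∷ match ∷ [])
            ∷ (parity ∷ copy   ∷ none  ∷ none  ∷ match ∷ match ∷ [])
            ∷ (match  ∷ none   ∷ none  ∷ match ∷ none  ∷ match ∷ [])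
            ∷ (match  ∷ none   ∷ match ∷ none  ∷ match ∷ none  ∷ [])
            ∷ (match  ∷ match  ∷ none  ∷ match ∷ none  ∷ none  ∷ [])
            ∷ (match  ∷ match  ∷ match ∷ none  ∷ none  ∷ none  ∷ [])
            ∷ []

layout : Fin 6 → Fin 6 → Kind
layout x y = lookup (lookup layoutTable x) y

layout-sym : ∀ x y → layout x y ≡ layout y x
layout-sym = toWitness {a? = all? λ x → all? λ y → layout x y ≟ layout y x} tt

layout-diagonal : ∀ x → layout x x ≡ none ⊎ layout x x ≡ copy
layout-diagonal = toWitness {a? = all? λ x → (layout x x ≟ none) ⊎-dec (layout x x ≟ copy)} tt

layout-matched : ∀ x → ∃ λ z → z ≢ x × layout z x ≡ match
layout-matched = toWitness {a? = all? λ x → any? λ z → ¬? (z ≟ x) ×-dec (layout z x ≟ match)} tt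

layout-separated : ∀ x y → x ≢ y → ∃ λ z → z ≢ x × z ≢ y ×
  (layout z x ≡ match × layout z y ≡ none ⊎ layout z x ≡ none × layout z y ≡ match)
layout-separated = toWitness {a? = all? λ x → all? λ y → ¬? (x ≟ y) →-dec any? λ z →
  ¬? (z ≟ x) ×-dec ¬? (z ≟ y) ×-dec
  ((layout z x ≟ match ×-dec layout z y ≟ none) ⊎-dec (layout z x ≟ none ×-dec layout z y ≟ match))} tt

-- Every row of the layout has odd total weight, whatever the degree d: rows
-- 0 and 1 weigh d + [d even] + 4 and d + [d even] + 2, the others 3.
layout-odd : ∀ x d → sum (tabulate (λ y → weight (layout x y) d)) % 2 ≡ 1
layout-odd zero d =
  trans (cong (_% 2) (sym (+-assoc d (bit (isEven d)) 4))) (parity-completion-+-even d 2)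
layout-odd (suc zero) d =
  trans (cong (_% 2) (trans (sym (+-assoc (bit (isEven d)) d 2))
                            (cong (_+ 2) (+-comm (bit (isEven d)) d))))
        (parity-completion-+-even d 1)
layout-odd (suc (suc zero))                   d = refl
layout-odd (suc (suc (suc zero)))             d = refl
layout-odd (suc (suc (suc (suc zero))))       d = refl
layout-odd (suc (suc (suc (suc (suc zero))))) d = refl

module Construction {n : ℕ} (G : Graph n) where
  open EdgeKinds G

  R : Fin 6 → Fin 6 → Fin n → Fin n → Bool
  R x y = ⟦ layout x y ⟧

  R-sym : ∀ x y i j → R x y i j ≡ R y x j i
  R-sym x y i j = trans (cong (λ κ → ⟦ κ ⟧ i j) (layout-sym x y)) (⟦⟧-sym (layout y x) i j)

  R-irrefl : ∀ x i → R x x i i ≡ false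
  R-irrefl x = ⟦⟧-loopless (layout x x) (layout-diagonal x)

  open Layered R R-sym R-irrefl public

  odd : IsOdd graph
  odd u with combine-surjective {6} {n} u
  ... | x , i , refl = begin
    degree graph (combine x i) % 2                                   ≡⟨ cong (_% 2) (degree-combine x i) ⟩
    sum (tabulate (λ y → size (R x y i))) % 2                        ≡⟨ cong (λ s → sum s % 2)
                                                                          (tabulate-cong (λ y → size-⟦⟧ (layout x y) i)) ⟩
    sum (tabulate (λ y → weight (layout x y) (degree G i))) % 2      ≡⟨ layout-odd x (degree G i) ⟩
    1                                                                ∎
    where open ≡-Reasoning

  matched : ∀ z x → layout z x ≡ match → Matched z x
  matched z x e l i = cong (λ κ → ⟦ κ ⟧ l i) e

  empty : ∀ z x → layout z x ≡ none → Empty z x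
  empty z x e l i = cong (λ κ → ⟦ κ ⟧ l i) e

  irreducible : ∀ u v → u ≢ v → ∃ λ w → Distinguishes graph w u v
  irreducible = distinguished matched-layer separated-layers
    where
    matched-layer : ∀ (x : Fin 6) → ∃ λ z → z ≢ x × Matched z x
    matched-layer x with layout-matched x
    ... | z , z≢x , e = z , z≢x , matched z x e

    separated-layers : ∀ (x y : Fin 6) → x ≢ y → ∃ λ z → z ≢ x × z ≢ y × (Matched z x × Empty z y ⊎ Empty z x × Matched z y)
    separated-layers x y x≢y with layout-separated x y x≢y
    ... | z , z≢x , z≢y , inj₁ (e₁ , e₀) = z , z≢x , z≢y , inj₁ (matched z x e₁ , empty z y e₀)
    ... | z , z≢x , z≢y , inj₂ (e₀ , e₁) = z , z≢x , z≢y , inj₂ (empty z x e₀ , matched z y e₁)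

  embedding : IsInducedSubgraphOf G graph
  embedding = layer-embedding {G} zero (λ i j → refl)

theorem2p1 : (n : ℕ) (G : Graph n) →
    Σ ℕ (λ m → Σ (Graph m) (λ G′ → IsIrreduciblyOdd G′ × IsInducedSubgraphOf G G′))
theorem2p1 n G = 6 * n , graph , (odd , irreducible) , embedding
  where open Construction G
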